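{- Let $k \geq 2$ and let $\mathcal{T}$ be a tree on $n > k$ taxa. Then $\mathcal{T}$ contains a split $A|B$ with $k \leq |B| \leq 2(k-1)$.
   Context: A tree (unrooted binary phylogenetic $X$-tree) is a finite unrooted tree in which every internal vertex has degree 3 and whose leaves are bijectively labelled by a finite set $X$ of taxa, $n=|X|$. A bipartition $A|B$ of $X$ is a split of $\mathcal{T}$ if deleting a single edge of $\mathcal{T}$ leaves two components whose taxa sets are $A$ and $B$. -}

module Defs where

open import Data.Nat using (ℕ; suc; _≤_; _+_)
open import Data.Fin using (Fin; zero; suc; inject₁; fromℕ)
open import Data.Bool using (Bool; true)
open import Data.Vec using (tabulate)
open import Data.Fin.Subset using (Subset; ∣_∣; _∈_)
open import Data.Product using (Σ; _×_; ∃-syntax)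
open import Data.Sum using (_⊎_)
open import Relation.Nullary using (¬_)
open import Relation.Binary.PropositionalEquality using (_≡_)
open import Relation.Binary.Construct.Closure.ReflexiveTransitive using (Star)
open import Function.Definitions using (Injective)
open import Function.Bundles using (_⇔_)

record SimpleGraph (m : ℕ) : Set where
  field
    adj       : Fin m → Fin m → Bool
    adj-sym   : ∀ u v → adj u v ≡ adj v u
    adj-irref : ∀ v → ¬ (adj v v ≡ true)

module _ {m : ℕ} (G : SimpleGraph m) where
  open SimpleGraph G

  Adj : Fin m → Fin m → Set
  Adj u v = adj u v ≡ true

  degree : Fin m → ℕ
  degree v = ∣ tabulate (adj v) ∣

  Connected : Set
  Connected = ∀ u v → Star Adj u v

  IsCycle : (j : ℕ) → (Fin (3 + j) → Fin m) → Set
  IsCycle j c = Injective _≡_ _≡_ c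
              × (∀ (i : Fin (2 + j)) → Adj (c (inject₁ i)) (c (suc i)))
              × Adj (c (fromℕ (2 + j))) (c zero)

  Acyclic : Set
  Acyclic = ∀ (j : ℕ) (c : Fin (3 + j) → Fin m) → ¬ IsCycle j c

  IsTree : Set
  IsTree = Connected × Acyclic

  AdjWithout : Fin m → Fin m → Fin m → Fin m → Set
  AdjWithout u v x y = Adj x y × ¬ ((x ≡ u × y ≡ v) ⊎ (x ≡ v × y ≡ u))

-- Unrooted binary phylogenetic X-tree with X = Fin n:
-- a tree whose vertices of degree ≤ 1 (leaves) are bijectively labelled by
-- Fin n and all other (internal) vertices have degree exactly 3.
record PhyloTree (n : ℕ) : Set where
  field
    m        : ℕ
    graph    : SimpleGraph m
    isTree   : IsTree graph
    label    : Fin n → Fin m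
    label-inj : Injective _≡_ _≡_ label
    label-leaf : ∀ x → degree graph (label x) ≤ 1
    leaf-labelled : ∀ v → degree graph v ≤ 1 → ∃[ x ] label x ≡ v
    internal-deg3 : ∀ v → ¬ (degree graph v ≤ 1) → degree graph v ≡ 3

module _ {n : ℕ} (T : PhyloTree n) where
  open PhyloTree T

  -- B is one side of the split induced by the edge {u,v}: the set of taxa
  -- lying in the component containing v after deleting the edge {u,v}.
  -- (A is the complement; taking either orientation of the edge covers both sides.)
  IsSplitSide : Subset n → Set
  IsSplitSide B = Σ (Fin m) λ u → Σ (Fin m) λ v →
    Adj graph u v ×
    (∀ x → (x ∈ B) ⇔ Star (AdjWithout graph u v) v (label x))

-- Orient each edge uv towards v and let side u v be the taxa beyond it. The pendant edge
-- at a leaf has n − 1 ≥ k taxa beyond it. If an oriented edge uv has more than 2(k − 1)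
-- taxa beyond it, then v is not a leaf, so it is internal with two further neighbours
-- w₁, w₂, and since every taxon is a leaf, side u v is the disjoint union of side v w₁ and
-- side v w₂; one of these still has at least k taxa, and we move on to that edge. The set of
-- vertices beyond the edge strictly shrinks, so this descent ends at a side with between k
-- and 2(k − 1) taxa.
module Submission where

open import Defs

open import Data.Nat using (ℕ; zero; suc; _+_; _*_; _∸_; _≤_; _<_; z≤n; s≤s; s≤s⁻¹; _≤?_)
open import Data.Nat.Induction using (<-wellFounded)
open import Induction.WellFounded using (Acc; acc)
open import Data.Nat.Properties
  using (+-suc; +-comm; +-identityʳ; +-mono-≤; suc-injective; ≤-reflexive; ≤-trans; <⇒≱; ≰⇒>; ∸-monoʳ-<;
         module ≤-Reasoning)
open import Data.Bool using (Bool; true)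
import Data.Bool.Properties as Bool
open import Data.Fin using (Fin; zero; suc; fromℕ; inject₁)
import Data.Fin.Properties as Fin
open import Data.Fin.Properties using (_≟_; any?; 0≢1+n)
open import Data.Fin.Subset
  using (Subset; inside; outside; _∈_; _∉_; _⊆_; _⊂_; ⊤; _∪_; _∩_; _─_; _-_; ⁅_⁆; ∣_∣; Nonempty; Empty)
open import Data.Fin.Subset.Properties
open import Data.Vec using ([]; _∷_; here; there; tabulate)
open import Data.Vec.Properties using (lookup∘tabulate; []=⇒lookup; lookup⇒[]=)
open import Data.Product using (Σ; ∃; _×_; _,_; proj₁; proj₂)
open import Data.Sum using (_⊎_; inj₁; inj₂; [_,_]′)
import Data.Sum as Sum
open import Data.Empty using (⊥; ⊥-elim)
open import Function using (_∘_; id)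
open import Function.Definitions using (Injective)
open import Function.Bundles using (_⇔_; mk⇔; Equivalence)
open import Relation.Nullary using (¬_; Dec; yes; no; does; contradiction)
open import Relation.Nullary.Decidable using (dec-true; map′; _×-dec_; _⊎-dec_; ¬?; decidable-stable)
open import Relation.Binary using (Rel)
import Relation.Binary as B
open import Relation.Binary.Construct.Closure.ReflexiveTransitive using (Star; ε; _◅_; _◅◅_; fold; reverse)
  renaming (map to mapStar)
open import Relation.Unary using (Pred; Decidable)
open import Relation.Binary.PropositionalEquality
  using (_≡_; _≢_; refl; sym; trans; cong; subst; subst₂; module ≡-Reasoning)

private
  variable
    n : ℕ

x∈tabulate⇔ : ∀ {f : Fin n → Bool} {x} → x ∈ tabulate f ⇔ f x ≡ true
x∈tabulate⇔ {f = f} {x} = mk⇔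
  (λ x∈ → trans (sym (lookup∘tabulate f x)) ([]=⇒lookup x∈))
  (λ fx → lookup⇒[]= x (tabulate f) (trans (lookup∘tabulate f x) fx))

decSubset : ∀ {ℓ} {P : Pred (Fin n) ℓ} → Decidable P → Subset n
decSubset P? = tabulate (does ∘ P?)

x∈decSubset⇔ : ∀ {ℓ} {P : Pred (Fin n) ℓ} (P? : Decidable P) {x} → x ∈ decSubset P? ⇔ P x
x∈decSubset⇔ P? {x} = mk⇔
  (doesTrue⇒ (P? x) ∘ Equivalence.to x∈tabulate⇔)
  (Equivalence.from x∈tabulate⇔ ∘ dec-true (P? x))
  where
  doesTrue⇒ : ∀ {a} {A : Set a} (a? : Dec A) → does a? ≡ true → A
  doesTrue⇒ (yes a) _ = a

x∈p─q⇒x∉q : ∀ {p q : Subset n} {x} → x ∈ p ─ q → x ∉ q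
x∈p─q⇒x∉q {p = _ ∷ _} {outside ∷ _} here ()
x∈p─q⇒x∉q {p = _ ∷ _} {_ ∷ _} (there x∈) (there x∈q) = x∈p─q⇒x∉q x∈ x∈q

∣p∪q∣≡∣p∣+∣q∣ : ∀ {p q : Subset n} → Empty (p ∩ q) → ∣ p ∪ q ∣ ≡ ∣ p ∣ + ∣ q ∣
∣p∪q∣≡∣p∣+∣q∣ {p = []} {[]} _ = refl
∣p∪q∣≡∣p∣+∣q∣ {p = inside ∷ p} {inside ∷ q} disj = ⊥-elim (disj (zero , here))
∣p∪q∣≡∣p∣+∣q∣ {p = inside ∷ p} {outside ∷ q} disj = cong suc (∣p∪q∣≡∣p∣+∣q∣ (drop-∷-Empty disj))
∣p∪q∣≡∣p∣+∣q∣ {p = outside ∷ p} {inside ∷ q} disj =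
  trans (cong suc (∣p∪q∣≡∣p∣+∣q∣ (drop-∷-Empty disj))) (sym (+-suc ∣ p ∣ ∣ q ∣))
∣p∪q∣≡∣p∣+∣q∣ {p = outside ∷ p} {outside ∷ q} disj = ∣p∪q∣≡∣p∣+∣q∣ (drop-∷-Empty disj)

x∈p-y⁻ : ∀ (p : Subset n) {x y} → x ∈ p - y → x ∈ p × x ≢ y
x∈p-y⁻ p {y = y} x∈ = p─q⊆p p ⁅ y ⁆ x∈ , x∉⁅y⁆⇒x≢y (x∈p─q⇒x∉q x∈)

x∈p⇒p≡p-x∪⁅x⁆ : ∀ {p : Subset n} {x} → x ∈ p → p ≡ (p - x) ∪ ⁅ x ⁆
x∈p⇒p≡p-x∪⁅x⁆ {p = p} {x} x∈p = ⊆-antisym forth back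
  where
  forth : ∀ {y} → y ∈ p → y ∈ (p - x) ∪ ⁅ x ⁆
  forth {y} y∈p with y ≟ x
  ... | yes refl = x∈p∪q⁺ (inj₂ (x∈⁅x⁆ x))
  ... | no y≢x = x∈p∪q⁺ (inj₁ (x∈p∧x≢y⇒x∈p-y y∈p y≢x))
  back : ∀ {y} → y ∈ (p - x) ∪ ⁅ x ⁆ → y ∈ p
  back y∈ with x∈p∪q⁻ (p - x) ⁅ x ⁆ y∈
  ... | inj₁ y∈p-x = p─q⊆p p ⁅ x ⁆ y∈p-x
  ... | inj₂ y∈⁅x⁆ = subst (_∈ p) (sym (x∈⁅y⁆⇒x≡y x y∈⁅x⁆)) x∈p

x∈p⇒∣p∣≡1+∣p-x∣ : ∀ {p : Subset n} {x} → x ∈ p → ∣ p ∣ ≡ suc ∣ p - x ∣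
x∈p⇒∣p∣≡1+∣p-x∣ {p = p} {x} x∈p = begin
  ∣ p ∣                    ≡⟨ cong ∣_∣ (x∈p⇒p≡p-x∪⁅x⁆ x∈p) ⟩
  ∣ (p - x) ∪ ⁅ x ⁆ ∣      ≡⟨ ∣p∪q∣≡∣p∣+∣q∣ disjoint ⟩
  ∣ p - x ∣ + ∣ ⁅ x ⁆ ∣    ≡⟨ cong (∣ p - x ∣ +_) (∣⁅x⁆∣≡1 x) ⟩
  ∣ p - x ∣ + 1            ≡⟨ +-comm ∣ p - x ∣ 1 ⟩
  suc ∣ p - x ∣            ∎
  where
  open ≡-Reasoning
  disjoint : Empty ((p - x) ∩ ⁅ x ⁆)
  disjoint (y , y∈) with x∈p∩q⁻ (p - x) ⁅ x ⁆ y∈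
  ... | y∈p-x , y∈⁅x⁆ = proj₂ (x∈p-y⁻ p y∈p-x) (x∈⁅y⁆⇒x≡y x y∈⁅x⁆)

x∈p⇒∣p-x∣≡c : ∀ {p : Subset n} {x c} → x ∈ p → ∣ p ∣ ≡ suc c → ∣ p - x ∣ ≡ c
x∈p⇒∣p-x∣≡c x∈p ∣p∣≡1+c = suc-injective (trans (sym (x∈p⇒∣p∣≡1+∣p-x∣ x∈p)) ∣p∣≡1+c)

∣⊤-x∣≡n : ∀ n (x : Fin (suc n)) → ∣ ⊤ - x ∣ ≡ n
∣⊤-x∣≡n n x = x∈p⇒∣p-x∣≡c {p = ⊤} {x = x} ∈⊤ (∣⊤∣≡n (suc n))

Empty⇒∣p∣≡0 : ∀ {p : Subset n} → Empty p → ∣ p ∣ ≡ 0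
Empty⇒∣p∣≡0 {n} empty = trans (cong ∣_∣ (Empty-unique empty)) (∣⊥∣≡0 n)

∣p∣≡0⇒Empty : ∀ {p : Subset n} → ∣ p ∣ ≡ 0 → Empty p
∣p∣≡0⇒Empty ∣p∣≡0 (x , x∈p) with () ← trans (sym ∣p∣≡0) (x∈p⇒∣p∣≡1+∣p-x∣ x∈p)

∣p∣≡1+c⇒Nonempty : ∀ {p : Subset n} {c} → ∣ p ∣ ≡ suc c → Nonempty p
∣p∣≡1+c⇒Nonempty {p = p} ∣p∣≡1+c with nonempty? p
... | yes ne = ne
... | no empty with () ← trans (sym ∣p∣≡1+c) (Empty⇒∣p∣≡0 empty)

subsingleton⇒∣p∣≤1 : ∀ {p : Subset n} → (∀ {x y} → x ∈ p → y ∈ p → x ≡ y) → ∣ p ∣ ≤ 1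
subsingleton⇒∣p∣≤1 {p = p} unique with nonempty? p
... | no empty = subst (_≤ 1) (sym (Empty⇒∣p∣≡0 empty)) z≤n
... | yes (x , x∈p) = subst (_≤ 1) (sym (x∈p⇒∣p∣≡1+∣p-x∣ x∈p)) (s≤s (≤-reflexive (Empty⇒∣p∣≡0 only-x)))
  where
  only-x : Empty (p - x)
  only-x (y , y∈p-x) = let y∈p , y≢x = x∈p-y⁻ p y∈p-x in y≢x (unique y∈p x∈p)

∣p∣≤1⇒subsingleton : ∀ {p : Subset n} → ∣ p ∣ ≤ 1 → ∀ {x y} → x ∈ p → y ∈ p → x ≡ y
∣p∣≤1⇒subsingleton {p = p} ∣p∣≤1 {x} {y} x∈p y∈p with y ≟ x
... | yes y≡x = sym y≡x
... | no y≢x with subst (_≤ 1) ∣p∣≡2+c ∣p∣≤1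
  where
  ∣p∣≡2+c : ∣ p ∣ ≡ suc (suc ∣ p - x - y ∣)
  ∣p∣≡2+c = trans (x∈p⇒∣p∣≡1+∣p-x∣ x∈p) (cong suc (x∈p⇒∣p∣≡1+∣p-x∣ (x∈p∧x≢y⇒x∈p-y y∈p y≢x)))
...   | s≤s ()

Star-invariant : ∀ {a p ℓ} {A : Set a} {R : Rel A ℓ} (P : A → Set p) →
                 (∀ {x y} → R x y → P x → P y) → ∀ {x y} → Star R x y → P x → P y
Star-invariant P preserves = fold (λ x y → P x → P y) (λ r k → k ∘ preserves r) id

Star-head : ∀ {a ℓ} {A : Set a} {R : Rel A ℓ} {x y} → Star R x y → x ≢ y → ∃ (R x)
Star-head ε x≢x = ⊥-elim (x≢x refl)
Star-head (r ◅ _) _ = _ , r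

mapAlong : ∀ {a ℓ₁ ℓ₂} {A : Set a} {R : Rel A ℓ₁} {S : Rel A ℓ₂} {x₀} →
           (∀ {x y} → Star R x₀ x → R x y → S x y) → ∀ {z} → Star R x₀ z → Star S x₀ z
mapAlong f ε = ε
mapAlong f (r ◅ w) = f ε r ◅ mapAlong (f ∘ (r ◅_)) w

module _ {m ℓ} {R : Rel (Fin m) ℓ} (R? : B.Decidable R) where

  Closed : Subset m → Set ℓ
  Closed S = ∀ {x y} → x ∈ S → R x y → y ∈ S

  ReachableClosedSet : Fin m → Set ℓ
  ReachableClosedSet a = Σ (Subset m) λ S → a ∈ S × (∀ {y} → y ∈ S → Star R a y) × Closed S

  saturate : ∀ {a} S → a ∈ S → (∀ {y} → y ∈ S → Star R a y) → Acc _<_ (m ∸ ∣ S ∣) →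
             ReachableClosedSet a
  saturate {a} S a∈S reachable (acc smaller)
    with any? (λ x → any? (λ y → x ∈? S ×-dec R? x y ×-dec ¬? (y ∈? S)))
  ... | no noExit = S , a∈S , reachable , λ {x} {y} x∈S r →
          decidable-stable (y ∈? S) (λ y∉S → noExit (x , y , x∈S , r , y∉S))
  ... | yes (x , y , x∈S , r , y∉S) =
          saturate S′ (p⊆p∪q _ a∈S) reachable′ (smaller (∸-monoʳ-< (p⊂q⇒∣p∣<∣q∣ S⊂S′) (∣p∣≤n S′)))
    where
    S′ : Subset m
    S′ = S ∪ ⁅ y ⁆
    S⊂S′ : S ⊂ S′
    S⊂S′ = p⊆p∪q _ , y , x∈p∪q⁺ (inj₂ (x∈⁅x⁆ y)) , y∉S
    reachable′ : ∀ {z} → z ∈ S′ → Star R a z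
    reachable′ z∈S′ with x∈p∪q⁻ S ⁅ y ⁆ z∈S′
    ... | inj₁ z∈S = reachable z∈S
    ... | inj₂ z∈⁅y⁆ rewrite x∈⁅y⁆⇒x≡y y z∈⁅y⁆ = reachable x∈S ◅◅ (r ◅ ε)

  reachableClosedSet : ∀ a → ReachableClosedSet a
  reachableClosedSet a = saturate ⁅ a ⁆ (x∈⁅x⁆ a) start (<-wellFounded _)
    where
    start : ∀ {z} → z ∈ ⁅ a ⁆ → Star R a z
    start z∈⁅a⁆ rewrite x∈⁅y⁆⇒x≡y a z∈⁅a⁆ = ε

  Star? : B.Decidable (Star R)
  Star? a y =
    let S , a∈S , reachable , closed = reachableClosedSet a
    in map′ reachable (λ a⇝y → Star-invariant (_∈ S) (λ r x∈S → closed x∈S r) a⇝y a∈S) (y ∈? S)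

module _ {m ℓ} (R : Rel (Fin m) ℓ) where

  record Path (r : ℕ) (a b : Fin m) : Set ℓ where
    field
      vertex    : Fin (suc r) → Fin m
      start     : vertex zero ≡ a
      end       : vertex (fromℕ r) ≡ b
      injective : Injective _≡_ _≡_ vertex
      step      : ∀ (i : Fin r) → R (vertex (inject₁ i)) (vertex (suc i))

  open Path

  trivialPath : ∀ a → Path 0 a a
  trivialPath a = record
    { vertex = λ _ → a ; start = refl ; end = refl
    ; injective = λ { {zero} {zero} _ → refl } ; step = λ () }

  prepend : ∀ {r a b c} → R a b → (p : Path r b c) → (∀ i → vertex p i ≢ a) → Path (suc r) a c
  prepend {r} {a} rab p fresh = record
    { vertex = vertex′ ; start = refl ; end = end p ; injective = injective′ ; step = step′ }
    where
    vertex′ : Fin (suc (suc r)) → Fin m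
    vertex′ zero = a
    vertex′ (suc i) = vertex p i
    injective′ : Injective _≡_ _≡_ vertex′
    injective′ {zero} {zero} _ = refl
    injective′ {zero} {suc j} e = ⊥-elim (fresh j (sym e))
    injective′ {suc i} {zero} e = ⊥-elim (fresh i e)
    injective′ {suc i} {suc j} e = cong suc (injective p e)
    step′ : ∀ (i : Fin (suc r)) → R (vertex′ (inject₁ i)) (vertex′ (suc i))
    step′ zero = subst (R a) (sym (start p)) rab
    step′ (suc i) = step p i

  suffix : ∀ {r a c} (p : Path r a c) (i : Fin (suc r)) → ∃ λ r′ → Path r′ (vertex p i) c
  suffix {r} p zero = r , record
    { vertex = vertex p ; start = refl ; end = end p ; injective = injective p ; step = step p }
  suffix {suc r} p (suc i) = suffix tail i
    where
    tail : Path r (vertex p (suc zero)) _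
    tail = record
      { vertex = vertex p ∘ suc ; start = refl ; end = end p
      ; injective = Fin.suc-injective ∘ injective p ; step = step p ∘ suc }

  Star⇒Path : ∀ {a b} → Star R a b → ∃ λ r → Path r a b
  Star⇒Path {a} ε = 0 , trivialPath a
  Star⇒Path {a} (rab ◅ w) with Star⇒Path w
  ... | r , p with any? (λ i → vertex p i ≟ a)
  ... | yes (i , pᵢ≡a) = subst (λ x → ∃ λ r′ → Path r′ x _) pᵢ≡a (suffix p i)
  ... | no a∉p = suc r , prepend rab p (λ i pᵢ≡a → a∉p (i , pᵢ≡a))

module _ {m} (G : SimpleGraph m) where
  open SimpleGraph G

  private
    variable
      u v x y z : Fin m

  Adj-sym : Adj G x y → Adj G y x
  Adj-sym {x} {y} xy = trans (adj-sym y x) xy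

  Adj-irrefl : Adj G x y → x ≢ y
  Adj-irrefl xy refl = adj-irref _ xy

  AdjWithout? : ∀ u v → B.Decidable (AdjWithout G u v)
  AdjWithout? u v x y =
    (adj x y Bool.≟ true) ×-dec ¬? ((x ≟ u ×-dec y ≟ v) ⊎-dec (x ≟ v ×-dec y ≟ u))

  AdjWithout-sym : AdjWithout G u v x y → AdjWithout G u v y x
  AdjWithout-sym (xy , ¬uv) = Adj-sym xy , λ
    { (inj₁ (y≡u , x≡v)) → ¬uv (inj₂ (x≡v , y≡u))
    ; (inj₂ (y≡v , x≡u)) → ¬uv (inj₁ (x≡u , y≡v)) }

  AdjWithout-swap : AdjWithout G u v x y → AdjWithout G v u x y
  AdjWithout-swap (xy , ¬uv) = xy , λ
    { (inj₁ (x≡v , y≡u)) → ¬uv (inj₂ (x≡v , y≡u))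
    ; (inj₂ (x≡u , y≡v)) → ¬uv (inj₁ (x≡u , y≡v)) }

  AdjWithout⁺ : Adj G x y → x ≢ v → y ≢ v → AdjWithout G u v x y
  AdjWithout⁺ xy x≢v y≢v = xy , λ
    { (inj₁ (_ , y≡v)) → y≢v y≡v
    ; (inj₂ (x≡v , _)) → x≢v x≡v }

  x∈neighbours⇔ : x ∈ tabulate (adj v) ⇔ Adj G v x
  x∈neighbours⇔ = x∈tabulate⇔

  leaf-neighbour-unique : degree G v ≤ 1 → Adj G v x → Adj G v y → x ≡ y
  leaf-neighbour-unique leaf vx vy =
    ∣p∣≤1⇒subsingleton leaf (Equivalence.from x∈neighbours⇔ vx) (Equivalence.from x∈neighbours⇔ vy)

  leaf-component : degree G v ≤ 1 → Adj G v u → Star (AdjWithout G u v) v y → y ≡ v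
  leaf-component leaf vu ε = refl
  leaf-component leaf vu ((vz , ¬uv) ◅ _) = ⊥-elim (¬uv (inj₂ (refl , leaf-neighbour-unique leaf vz vu)))

  record OtherNeighbours (v u : Fin m) : Set where
    field
      w₁ w₂      : Fin m
      adj₁       : Adj G v w₁
      adj₂       : Adj G v w₂
      w₁≢w₂      : w₁ ≢ w₂
      w₁≢u       : w₁ ≢ u
      w₂≢u       : w₂ ≢ u
      exhaustive : Adj G v z → z ≡ u ⊎ z ≡ w₁ ⊎ z ≡ w₂

  -- Opaque because nothing computes with the chosen neighbours, while unfolding them
  -- in the types of their sides makes type checking the descent prohibitively slow.
  opaque
    otherNeighbours : degree G v ≡ 3 → Adj G v u → OtherNeighbours v u
    otherNeighbours {v} {u} deg≡3 vu =
      let w₁ , w₁∈N-u = ∣p∣≡1+c⇒Nonempty ∣N-u∣≡2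
          ∣N-u-w₁∣≡1 = x∈p⇒∣p-x∣≡c w₁∈N-u ∣N-u∣≡2
          w₂ , w₂∈N-u-w₁ = ∣p∣≡1+c⇒Nonempty ∣N-u-w₁∣≡1
          w₁∈N , w₁≢u = x∈p-y⁻ N w₁∈N-u
          w₂∈N-u , w₂≢w₁ = x∈p-y⁻ (N - u) w₂∈N-u-w₁
          w₂∈N , w₂≢u = x∈p-y⁻ N w₂∈N-u
      in record
        { w₁ = w₁ ; w₂ = w₂
        ; adj₁ = Equivalence.to x∈neighbours⇔ w₁∈N ; adj₂ = Equivalence.to x∈neighbours⇔ w₂∈N
        ; w₁≢w₂ = w₂≢w₁ ∘ sym ; w₁≢u = w₁≢u ; w₂≢u = w₂≢u
        ; exhaustive = exhaustive (x∈p⇒∣p-x∣≡c w₂∈N-u-w₁ ∣N-u-w₁∣≡1) }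
      where
      N : Subset m
      N = tabulate (adj v)
      ∣N-u∣≡2 : ∣ N - u ∣ ≡ 2
      ∣N-u∣≡2 = x∈p⇒∣p-x∣≡c (Equivalence.from x∈neighbours⇔ vu) deg≡3
      exhaustive : ∀ {w₁ w₂ z} → ∣ N - u - w₁ - w₂ ∣ ≡ 0 → Adj G v z → z ≡ u ⊎ z ≡ w₁ ⊎ z ≡ w₂
      exhaustive {w₁} {w₂} {z} ∣N-u-w₁-w₂∣≡0 vz with z ≟ u | z ≟ w₁ | z ≟ w₂
      ... | yes z≡u | _        | _        = inj₁ z≡u
      ... | no _    | yes z≡w₁ | _        = inj₂ (inj₁ z≡w₁)
      ... | no _    | no _     | yes z≡w₂ = inj₂ (inj₂ z≡w₂)
      ... | no z≢u  | no z≢w₁  | no z≢w₂  = ⊥-elim (∣p∣≡0⇒Empty ∣N-u-w₁-w₂∣≡0 (z , z∈N-u-w₁-w₂))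
        where
        z∈N-u-w₁-w₂ : z ∈ N - u - w₁ - w₂
        z∈N-u-w₁-w₂ = x∈p∧x≢y⇒x∈p-y
          (x∈p∧x≢y⇒x∈p-y (x∈p∧x≢y⇒x∈p-y (Equivalence.from x∈neighbours⇔ vz) z≢u) z≢w₁) z≢w₂

  sides-cover : Connected G → Adj G u v → ∀ y → Star (AdjWithout G u v) v y ⊎ Star (AdjWithout G u v) u y
  sides-cover {u} {v} connected uv y = Star-invariant Reached extend (connected v y) (inj₁ ε)
    where
    Reached : Fin m → Set
    Reached x = Star (AdjWithout G u v) v x ⊎ Star (AdjWithout G u v) u x
    extend : Adj G x z → Reached x → Reached z
    extend {x} {z} xz reached with (x ≟ u ×-dec z ≟ v) ⊎-dec (x ≟ v ×-dec z ≟ u)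
    ... | yes (inj₁ (_ , refl)) = inj₁ ε
    ... | yes (inj₂ (_ , refl)) = inj₂ ε
    ... | no notUV = Sum.map (_◅◅ ((xz , notUV) ◅ ε)) (_◅◅ ((xz , notUV) ◅ ε)) reached

  module _ {u v : Fin m} (uv : Adj G u v) (others : OtherNeighbours v u) where
    open OtherNeighbours others

    branch-cover : Star (AdjWithout G u v) v y →
                   y ≡ v ⊎ Star (AdjWithout G v w₁) w₁ y ⊎ Star (AdjWithout G v w₂) w₂ y
    branch-cover w = Star-invariant Branch extend w (inj₁ refl)
      where
      Branch : Fin m → Set
      Branch y = y ≡ v ⊎ Star (AdjWithout G v w₁) w₁ y ⊎ Star (AdjWithout G v w₂) w₂ y
      extend : AdjWithout G u v x z → Branch x → Branch z
      extend {x} {z} (xz , notUV) branch with z ≟ v | x ≟ v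
      ... | yes z≡v | _ = inj₁ z≡v
      ... | no z≢v | yes refl with exhaustive xz
      ...   | inj₁ z≡u = ⊥-elim (notUV (inj₂ (refl , z≡u)))
      ...   | inj₂ (inj₁ refl) = inj₂ (inj₁ ε)
      ...   | inj₂ (inj₂ refl) = inj₂ (inj₂ ε)
      extend (xz , _) (inj₁ x≡v) | no _ | no x≢v = ⊥-elim (x≢v x≡v)
      extend (xz , _) (inj₂ (inj₁ w)) | no z≢v | no x≢v =
        inj₂ (inj₁ (w ◅◅ (AdjWithout-swap (AdjWithout⁺ xz x≢v z≢v) ◅ ε)))
      extend (xz , _) (inj₂ (inj₂ w)) | no z≢v | no x≢v =
        inj₂ (inj₂ (w ◅◅ (AdjWithout-swap (AdjWithout⁺ xz x≢v z≢v) ◅ ε)))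

module _ {m} (G : SimpleGraph m) (acyclic : Acyclic G) where
  open Path

  private
    variable
      u v w y : Fin m

  bridge : Adj G u v → ¬ Star (AdjWithout G u v) v u
  bridge uv w with Star⇒Path _ w
  ... | 0 , p = Adj-irrefl G uv (trans (sym (end p)) (start p))
  ... | 1 , p = proj₂ (step p zero) (inj₂ (start p , end p))
  ... | suc (suc j) , p = acyclic j (vertex p)
        (injective p , proj₁ ∘ step p , subst₂ (Adj G) (sym (end p)) (sym (start p)) uv)

  component-excludes : Adj G v w → Star (AdjWithout G v w) w y → y ≢ v
  component-excludes vw w refl = bridge vw w

  component-nested : ∀ {u v w y} → Adj G u v → Adj G v w → w ≢ u →
                     Star (AdjWithout G v w) w y → Star (AdjWithout G u v) v y
  component-nested {u} {v} {w} uv vw w≢u walk = first ◅ mapAlong avoidsV walk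
    where
    first : AdjWithout G u v v w
    first = vw , λ { (inj₁ (v≡u , _)) → Adj-irrefl G uv (sym v≡u) ; (inj₂ (_ , w≡u)) → w≢u w≡u }
    avoidsV : ∀ {x z} → Star (AdjWithout G v w) w x → AdjWithout G v w x z → AdjWithout G u v x z
    avoidsV reached r = AdjWithout⁺ G (proj₁ r) (component-excludes vw reached)
                                     (component-excludes vw (reached ◅◅ (r ◅ ε)))

  component-disjoint : ∀ {v w₁ w₂ y} → Adj G v w₁ → Adj G v w₂ → w₁ ≢ w₂ →
                       Star (AdjWithout G v w₁) w₁ y → Star (AdjWithout G v w₂) w₂ y → ⊥
  component-disjoint {v} {w₁} {w₂} vw₁ vw₂ w₁≢w₂ walk₁ walk₂ =
    bridge vw₁ (walk₁ ◅◅ reverse (AdjWithout-sym G) (mapAlong avoidsV walk₂) ◅◅ (last ◅ ε))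
    where
    last : AdjWithout G v w₁ w₂ v
    last = Adj-sym G vw₂ , λ
      { (inj₁ (w₂≡v , _)) → Adj-irrefl G vw₂ (sym w₂≡v)
      ; (inj₂ (w₂≡w₁ , _)) → w₁≢w₂ (sym w₂≡w₁) }
    avoidsV : ∀ {x z} → Star (AdjWithout G v w₂) w₂ x → AdjWithout G v w₂ x z → AdjWithout G v w₁ x z
    avoidsV reached r = AdjWithout-swap G (AdjWithout⁺ G (proj₁ r) (component-excludes vw₂ reached)
                                     (component-excludes vw₂ (reached ◅◅ (r ◅ ε))))

module _ {n} (T : PhyloTree n) where
  open PhyloTree T

  component : Fin m → Fin m → Subset m
  component u v = decSubset (Star? (AdjWithout? graph u v) v)

  side : Fin m → Fin m → Subset n
  side u v = decSubset (λ x → Star? (AdjWithout? graph u v) v (label x))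

  x∈component⇔ : ∀ {u v y} → y ∈ component u v ⇔ Star (AdjWithout graph u v) v y
  x∈component⇔ {u} {v} = x∈decSubset⇔ (Star? (AdjWithout? graph u v) v)

  x∈side⇔ : ∀ {u v x} → x ∈ side u v ⇔ Star (AdjWithout graph u v) v (label x)
  x∈side⇔ {u} {v} = x∈decSubset⇔ (λ x → Star? (AdjWithout? graph u v) v (label x))

  component⁺ : ∀ {u v y} → Star (AdjWithout graph u v) v y → y ∈ component u v
  component⁺ = Equivalence.from x∈component⇔

  component⁻ : ∀ {u v y} → y ∈ component u v → Star (AdjWithout graph u v) v y
  component⁻ = Equivalence.to x∈component⇔

  side⁺ : ∀ {u v x} → Star (AdjWithout graph u v) v (label x) → x ∈ side u v
  side⁺ = Equivalence.from x∈side⇔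

  side⁻ : ∀ {u v x} → x ∈ side u v → Star (AdjWithout graph u v) v (label x)
  side⁻ = Equivalence.to x∈side⇔

  label≢internal : ∀ {v} x → degree graph v ≡ 3 → label x ≢ v
  label≢internal x internal refl with s≤s () ← subst (_≤ 1) internal (label-leaf x)

  side-isSplitSide : ∀ {u v} → Adj graph u v → IsSplitSide T (side u v)
  side-isSplitSide {u} {v} uv = u , v , uv , λ x → x∈side⇔

  component-shrinks : ∀ {u v w} → Adj graph u v → Adj graph v w → w ≢ u →
                      ∣ component v w ∣ < ∣ component u v ∣
  component-shrinks {u} {v} {w} uv vw w≢u = p⊂q⇒∣p∣<∣q∣
    ( component⁺ {u} {v} ∘ component-nested graph (proj₂ isTree) uv vw w≢u ∘ component⁻ {v} {w}
    , v , component⁺ {u} {v} ε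
    , λ v∈ → component-excludes graph (proj₂ isTree) vw (component⁻ {v} {w} v∈) refl )

  leaf-side : ∀ {u v} → degree graph v ≤ 1 → Adj graph u v → ∣ side u v ∣ ≤ 1
  leaf-side {u} {v} leaf uv = subsingleton⇒∣p∣≤1 λ x∈ y∈ → label-inj (trans (at-leaf x∈) (sym (at-leaf y∈)))
    where
    at-leaf : ∀ {x} → x ∈ side u v → label x ≡ v
    at-leaf = leaf-component graph leaf (Adj-sym graph uv) ∘ side⁻

  module _ {u v} (uv : Adj graph u v) (internal : degree graph v ≡ 3) where
    others : OtherNeighbours graph v u
    others = otherNeighbours graph internal (Adj-sym graph uv)
    open OtherNeighbours others

    side-splits : ∣ side u v ∣ ≡ ∣ side v w₁ ∣ + ∣ side v w₂ ∣
    side-splits = begin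
      ∣ side u v ∣                  ≡⟨ cong ∣_∣ (⊆-antisym forth back) ⟩
      ∣ side v w₁ ∪ side v w₂ ∣     ≡⟨ ∣p∪q∣≡∣p∣+∣q∣ disjoint ⟩
      ∣ side v w₁ ∣ + ∣ side v w₂ ∣ ∎
      where
      open ≡-Reasoning
      forth : ∀ {x} → x ∈ side u v → x ∈ side v w₁ ∪ side v w₂
      forth {x} x∈ = x∈p∪q⁺ ([ ⊥-elim ∘ label≢internal x internal , Sum.map side⁺ side⁺ ]′
                                (branch-cover graph uv others (side⁻ x∈)))
      back : ∀ {x} → x ∈ side v w₁ ∪ side v w₂ → x ∈ side u v
      back {x} x∈ with x∈p∪q⁻ (side v w₁) (side v w₂) x∈
      ... | inj₁ x∈₁ = side⁺ {u} {v} (component-nested graph (proj₂ isTree) uv adj₁ w₁≢u (side⁻ {v} {w₁} x∈₁))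
      ... | inj₂ x∈₂ = side⁺ {u} {v} (component-nested graph (proj₂ isTree) uv adj₂ w₂≢u (side⁻ {v} {w₂} x∈₂))
      disjoint : Empty (side v w₁ ∩ side v w₂)
      disjoint (x , x∈) with x∈p∩q⁻ (side v w₁) (side v w₂) x∈
      ... | x∈₁ , x∈₂ = component-disjoint graph (proj₂ isTree) adj₁ adj₂ w₁≢w₂
                          (side⁻ {v} {w₁} x∈₁) (side⁻ {v} {w₂} x∈₂)

module _ {n} (T : PhyloTree (suc (suc n))) where
  open PhyloTree T

  pendant-side : Σ (Fin m) λ ℓ → Σ (Fin m) λ p → Adj graph ℓ p × suc n ≤ ∣ side T ℓ p ∣
  pendant-side =
    let p , ℓp = Star-head (proj₁ isTree ℓ (label (suc zero))) (λ ℓ≡label₁ → 0≢1+n (label-inj ℓ≡label₁))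
    in ℓ , p , ℓp , subst (_≤ ∣ side T ℓ p ∣) (∣⊤-x∣≡n (suc n) zero) (p⊆q⇒∣p∣≤∣q∣ (others-inside {p} ℓp))
    where
    ℓ : Fin m
    ℓ = label zero
    others-inside : ∀ {p} → Adj graph ℓ p → ⊤ - zero ⊆ side T ℓ p
    others-inside {p} ℓp {x} x∈ with sides-cover graph (proj₁ isTree) ℓp (label x)
    ... | inj₁ walk = side⁺ T walk
    ... | inj₂ walk = ⊥-elim (proj₂ (x∈p-y⁻ ⊤ x∈) (label-inj
            (leaf-component graph (label-leaf zero) ℓp (mapStar (AdjWithout-swap graph) walk))))

a<k⇒b<k⇒a+b≤2*[k∸1] : ∀ {a b k} → a < k → b < k → a + b ≤ 2 * (k ∸ 1)
a<k⇒b<k⇒a+b≤2*[k∸1] {a} {b} {suc k} (s≤s a≤k) (s≤s b≤k) = begin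
  a + b        ≤⟨ +-mono-≤ a≤k b≤k ⟩
  k + k        ≡⟨ cong (k +_) (sym (+-identityʳ k)) ⟩
  2 * k        ∎
  where open ≤-Reasoning

module _ {n} (T : PhyloTree n) {k} (2≤k : 2 ≤ k) where
  open PhyloTree T

  SplitSideOfSize : Set
  SplitSideOfSize = Σ (Subset n) λ B → IsSplitSide T B × k ≤ ∣ B ∣ × ∣ B ∣ ≤ 2 * (k ∸ 1)

  descend : ∀ {u v} → Adj graph u v → Acc _<_ ∣ component T u v ∣ → k ≤ ∣ side T u v ∣ → SplitSideOfSize
  descend {u} {v} uv (acc smaller) k≤∣side∣ with ∣ side T u v ∣ ≤? 2 * (k ∸ 1)
  ... | yes small = side T u v , side-isSplitSide T uv , k≤∣side∣ , small
  ... | no large with degree graph v ≤? 1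
  ...   | yes leaf = contradiction (leaf-side T leaf uv) (<⇒≱ (≤-trans 2≤k k≤∣side∣))
  ...   | no ¬leaf = descendBelow (k ≤? ∣ side T v w₁ ∣) (k ≤? ∣ side T v w₂ ∣)
    where
    internal : degree graph v ≡ 3
    internal = internal-deg3 v ¬leaf
    open OtherNeighbours (others T uv internal)
    descendBelow : Dec (k ≤ ∣ side T v w₁ ∣) → Dec (k ≤ ∣ side T v w₂ ∣) → SplitSideOfSize
    descendBelow (yes k≤₁) _ = descend adj₁ (smaller (component-shrinks T uv adj₁ w₁≢u)) k≤₁
    descendBelow (no _) (yes k≤₂) = descend adj₂ (smaller (component-shrinks T uv adj₂ w₂≢u)) k≤₂
    descendBelow (no k≰₁) (no k≰₂) = contradiction
      (subst (_≤ 2 * (k ∸ 1)) (sym (side-splits T uv internal))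
        (a<k⇒b<k⇒a+b≤2*[k∸1] (≰⇒> k≰₁) (≰⇒> k≰₂)))
      large

lemma4p1 : (k n : ℕ) → 2 ≤ k → k < n → (T : PhyloTree n) →
    Σ (Subset n) λ B → IsSplitSide T B × k ≤ ∣ B ∣ × ∣ B ∣ ≤ 2 * (k ∸ 1)
lemma4p1 _ 0 _ ()
lemma4p1 _ 1 (s≤s (s≤s _)) (s≤s ())
lemma4p1 k (suc (suc n)) 2≤k k<n T =
  let ℓ , p , ℓp , n+1≤∣side∣ = pendant-side T
  in descend T 2≤k ℓp (<-wellFounded _) (≤-trans (s≤s⁻¹ k<n) n+1≤∣side∣)
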